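{- For every set $\Gamma\cup\{A\}$ of propositional formulas: $\Gamma\vdash_{i3g3}A$ if and only if $\Gamma\models_{i3g3}A$.
   Context: Propositional language $\mathcal{L}$: propositional variables, $\bot$, ${\sim}$, $\land,\lor,\to$; $\mathsf{Form}$ its formulas; $\neg A:=A\to\bot$, $A\leftrightarrow B:=(A\to B)\land(B\to A)$. $\vdash_{i3g3}$ is derivability in the Hilbert system with axioms $A\to(B\to A)$; $(A\to(B\to C))\to((A\to B)\to(A\to C))$; $(A\land B)\to A$; $(A\land B)\to B$; $(C\to A)\to((C\to B)\to(C\to(A\land B)))$; $A\to(A\lor B)$; $B\to(A\lor B)$; $(A\to C)\to((B\to C)\to((A\lor B)\to C))$; $\bot\to A$; $A\to{\sim}\bot$; ${\sim}{\sim}A\leftrightarrow A$; ${\sim}(A\land B)\leftrightarrow({\sim}A\lor{\sim}B)$; ${\sim}(A\lor B)\leftrightarrow({\sim}A\land{\sim}B)$; ${\sim}(A\to B)\leftrightarrow(\neg{\sim}A\land{\sim}B)$; ${\sim}A\to\neg A$; $\neg\neg(A\lor{\sim}A)$; (AxG) $A\lor(A\to B)\lor\neg B$; and the rule MP (from $A$, $A\to B$ infer $B$). $\Gamma\vdash_{i3g3}A$ means a finite list ending in $A$ of members of $\Gamma$, axiom instances, or MP consequences of earlier items. A propositional $\mathbf{BDi3}$-model is $\langle W,\le,V\rangle$ with $\le$ a partial order on nonempty $W$ having maximal successors, and $V(w,p)\subseteq\{0,1\}$ not containing both $0,1$, monotone along $\le$, and potentially omniscient (for all $x\ge w$ there is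 $y\ge x$ with $V(y,p)\ne\emptyset$). $I(w,A)\subseteq\{0,1\}$ extends $V$: $I(w,p)=V(w,p)$; $1\notin I(w,\bot)$, $0\in I(w,\bot)$; $1\in I(w,{\sim}A)$ iff $0\in I(w,A)$; $0\in I(w,{\sim}A)$ iff $1\in I(w,A)$; $1\in I(w,A\land B)$ iff both; $0\in I(w,A\land B)$ iff $0\in I(w,A)$ or $0\in I(w,B)$; $1\in I(w,A\lor B)$ iff $1\in I(w,A)$ or $1\in I(w,B)$; $0\in I(w,A\lor B)$ iff both have $0$; $1\in I(w,A\to B)$ iff for all $x\ge w$, $1\notin I(x,A)$ or $1\in I(x,B)$; $0\in I(w,A\to B)$ iff ($0\notin I(x,A)$ for all $x\ge w$) and $0\in I(w,B)$. $\Gamma\models_{i3g3}A$ iff for every such model whose order $\le$ is linear and $|W|\le 2$, and every $w\in W$, if $1\in I(w,B)$ for all $B\in\Gamma$ then $1\in I(w,A)$. -}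

module Defs where

open import Level using (0ℓ)
open import Data.Nat using (ℕ)
open import Data.Fin using (Fin)
open import Data.Empty using (⊥)
open import Data.Unit using (⊤)
open import Data.Product using (Σ; ∃; _×_; _,_)
open import Data.Sum using (_⊎_)
open import Relation.Nullary using (¬_)
open import Relation.Binary.PropositionalEquality using (_≡_)
open import Relation.Binary.Definitions using (Total)
open import Relation.Binary.Structures using (IsPartialOrder)
open import Function.Definitions using (Injective)

infixr 5 _⇒_
infixr 6 _∨'_
infixr 7 _∧'_

data Form : Set where
  var  : ℕ → Form
  ⊥'   : Form
  ∼_   : Form → Form
  _∧'_ : Form → Form → Form
  _∨'_ : Form → Form → Form
  _⇒_  : Form → Form → Form

¬'_ : Form → Form
¬' A = A ⇒ ⊥'

_⇔'_ : Form → Form → Form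
A ⇔' B = (A ⇒ B) ∧' (B ⇒ A)

data Axiom : Form → Set where
  ax-K    : ∀ A B → Axiom (A ⇒ (B ⇒ A))
  ax-S    : ∀ A B C → Axiom ((A ⇒ (B ⇒ C)) ⇒ ((A ⇒ B) ⇒ (A ⇒ C)))
  ax-∧E₁  : ∀ A B → Axiom ((A ∧' B) ⇒ A)
  ax-∧E₂  : ∀ A B → Axiom ((A ∧' B) ⇒ B)
  ax-∧I   : ∀ A B C → Axiom ((C ⇒ A) ⇒ ((C ⇒ B) ⇒ (C ⇒ (A ∧' B))))
  ax-∨I₁  : ∀ A B → Axiom (A ⇒ (A ∨' B))
  ax-∨I₂  : ∀ A B → Axiom (B ⇒ (A ∨' B))
  ax-∨E   : ∀ A B C → Axiom ((A ⇒ C) ⇒ ((B ⇒ C) ⇒ ((A ∨' B) ⇒ C)))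
  ax-⊥E   : ∀ A → Axiom (⊥' ⇒ A)
  ax-∼⊥   : ∀ A → Axiom (A ⇒ ∼ ⊥')
  ax-∼∼   : ∀ A → Axiom ((∼ (∼ A)) ⇔' A)
  ax-∼∧   : ∀ A B → Axiom ((∼ (A ∧' B)) ⇔' ((∼ A) ∨' (∼ B)))
  ax-∼∨   : ∀ A B → Axiom ((∼ (A ∨' B)) ⇔' ((∼ A) ∧' (∼ B)))
  ax-∼⇒   : ∀ A B → Axiom ((∼ (A ⇒ B)) ⇔' ((¬' (∼ A)) ∧' (∼ B)))
  ax-∼¬   : ∀ A → Axiom ((∼ A) ⇒ (¬' A))
  ax-¬¬LEM : ∀ A → Axiom (¬' (¬' (A ∨' (∼ A))))
  ax-G    : ∀ A B → Axiom ((A ∨' (A ⇒ B)) ∨' (¬' B))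

-- Sets of formulas are predicates on Form.
-- Derivability from Γ (derivation trees; equivalent to finite derivation lists).
infix 3 _⊢_
data _⊢_ (Γ : Form → Set) : Form → Set where
  hyp : ∀ {A} → Γ A → Γ ⊢ A
  ax  : ∀ {A} → Axiom A → Γ ⊢ A
  mp  : ∀ {A B} → Γ ⊢ A → Γ ⊢ (A ⇒ B) → Γ ⊢ B

data TV : Set where
  𝟘 𝟙 : TV

record Model : Set₁ where
  field
    W     : Set
    _≤_   : W → W → Set
    V     : W → ℕ → TV → Set          -- V w p v  means  v ∈ V(w,p)
    inhabited   : W
    partialOrder : IsPartialOrder _≡_ _≤_
    maxSucc     : ∀ w → Σ W λ m → (w ≤ m) × (∀ x → m ≤ x → x ≡ m)
    V-consistent : ∀ w p → ¬ (V w p 𝟘 × V w p 𝟙)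
    V-monotone  : ∀ {w x} p v → w ≤ x → V w p v → V x p v
    V-potOmni   : ∀ w p x → w ≤ x → Σ W λ y → (x ≤ y) × (V y p 𝟘 ⊎ V y p 𝟙)

module Interp (M : Model) where
  open Model M

  -- I1 w A : 1 ∈ I(w,A);  I0 w A : 0 ∈ I(w,A)
  I1 I0 : W → Form → Set
  I1 w (var p)   = V w p 𝟙
  I1 w ⊥'        = ⊥
  I1 w (∼ A)     = I0 w A
  I1 w (A ∧' B)  = I1 w A × I1 w B
  I1 w (A ∨' B)  = I1 w A ⊎ I1 w B
  I1 w (A ⇒ B)   = ∀ x → w ≤ x → (¬ I1 x A) ⊎ I1 x B
  I0 w (var p)   = V w p 𝟘
  I0 w ⊥'        = ⊤
  I0 w (∼ A)     = I1 w A
  I0 w (A ∧' B)  = I0 w A ⊎ I0 w B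
  I0 w (A ∨' B)  = I0 w A × I0 w B
  I0 w (A ⇒ B)   = (∀ x → w ≤ x → ¬ I0 x A) × I0 w B

Linear : Model → Set
Linear M = Total (Model._≤_ M)

AtMostTwo : Model → Set
AtMostTwo M = Σ (Model.W M → Fin 2) λ f → Injective _≡_ _≡_ f

infix 3 _⊨_
_⊨_ : (Form → Set) → Form → Set₁
Γ ⊨ A = (M : Model) → Linear M → AtMostTwo M →
        ∀ (w : Model.W M) → (∀ B → Γ B → Interp.I1 M w B) → Interp.I1 M w A

-- Soundness: every axiom except G holds in all models, and G holds whenever a model has at most
-- two worlds, because among w and two points above it some two coincide.
-- Completeness: extend Γ to a deductively closed theory T that avoids A and is maximal with this
-- property, hence prime. The two-world chain T ≤ T⁺, where T⁺ collects the formulas whose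
-- negation is not in T, is a model whose truths at each world are exactly the members of its
-- theory; so Γ holds and A fails at the bottom world. Axiom G is what makes T⁺ deductively
-- closed and what decides implications at the bottom world.
-- Excluded middle in the metatheory is needed throughout, since 1 ∈ I(w, A → B) asks for the
-- disjunction 1 ∉ I(x, A) or 1 ∈ I(x, B) at every x ≥ w.
module Submission where

open import Defs
open import Level using (0ℓ)
open import Axiom.ExcludedMiddle using (ExcludedMiddle)
open import Data.Nat as ℕ using (ℕ; zero; suc; _⊔_; z≤n)
open import Data.Nat.Base using (_≤′_; ≤′-reflexive; ≤′-step)
open import Data.Nat.Properties using (≤⇒≤′; m≤m⊔n; m≤n⊔m)
open import Data.Fin using (Fin) renaming (_≤_ to _≤ᶠ_)
open import Data.Fin.Patterns using (0F; 1F)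
open import Data.Fin.Properties using (≤fromℕ; ≤-total; ≤-isPartialOrder) renaming (≤-refl to ≤ᶠ-refl)
open import Data.List using (List; []; _∷_; _++_; map; concat; cartesianProductWith; foldl)
open import Data.List.Membership.Propositional using (_∈_)
open import Data.List.Membership.Propositional.Properties
  using (∈-++⁺ˡ; ∈-++⁺ʳ; ∈-map⁺; ∈-concat⁺′; ∈-cartesianProductWith⁺)
open import Data.List.Relation.Unary.Any using (here; there)
open import Data.Empty using (⊥-elim)
open import Data.Unit using (tt)
open import Data.Product using (∃; _×_; _,_; proj₁; proj₂)
open import Data.Product.Function.NonDependent.Propositional using (_×-⇔_)
open import Data.Sum using (_⊎_; inj₁; inj₂; [_,_]; map₁; map₂)
open import Data.Sum.Function.Propositional using (_⊎-⇔_)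
open import Function using (id; _∘_; const)
open import Function.Bundles using (_⇔_; mk⇔; Equivalence)
open import Function.Properties.Equivalence using () renaming (refl to ⇔-refl; sym to ⇔-sym; trans to ⇔-trans)
open import Relation.Nullary using (¬_; yes; no)
open import Relation.Nullary.Decidable using (decidable-stable)
open import Relation.Unary using (Pred; _⊆_; _∪_; ｛_｝)
open import Relation.Binary.PropositionalEquality using (_≡_; refl)
open import Relation.Binary.Structures using (IsPartialOrder)

open Equivalence using (to; from)

module Semantics (M : Model) where
  open Model M
  open Interp M
  open IsPartialOrder partialOrder using () renaming (refl to ≤-refl; trans to ≤-trans)

  I1-mono : ∀ A {w x} → w ≤ x → I1 w A → I1 x A
  I0-mono : ∀ A {w x} → w ≤ x → I0 w A → I0 x A
  I1-mono (var p)  w≤x a = V-monotone p 𝟙 w≤x a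
  I1-mono (∼ A)    w≤x a = I0-mono A w≤x a
  I1-mono (A ∧' B) w≤x (a , b) = I1-mono A w≤x a , I1-mono B w≤x b
  I1-mono (A ∨' B) w≤x (inj₁ a) = inj₁ (I1-mono A w≤x a)
  I1-mono (A ∨' B) w≤x (inj₂ b) = inj₂ (I1-mono B w≤x b)
  I1-mono (A ⇒ B)  w≤x f = λ y x≤y → f y (≤-trans w≤x x≤y)
  I0-mono (var p)  w≤x a = V-monotone p 𝟘 w≤x a
  I0-mono ⊥'       w≤x a = tt
  I0-mono (∼ A)    w≤x a = I1-mono A w≤x a
  I0-mono (A ∧' B) w≤x (inj₁ a) = inj₁ (I0-mono A w≤x a)
  I0-mono (A ∧' B) w≤x (inj₂ b) = inj₂ (I0-mono B w≤x b)
  I0-mono (A ∨' B) w≤x (a , b) = I0-mono A w≤x a , I0-mono B w≤x b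
  I0-mono (A ⇒ B)  w≤x (f , b) = (λ y x≤y → f y (≤-trans w≤x x≤y)) , I0-mono B w≤x b

  IsMaximal : W → Set
  IsMaximal m = ∀ x → m ≤ x → x ≡ m

  -- An implication cannot be both 1 and 0 at w because, at a maximal world above w, its antecedent is decided.
  I-consistent : ∀ A w → ¬ (I1 w A × I0 w A)
  I-decided : ∀ A {m} → IsMaximal m → I1 m A ⊎ I0 m A
  I-consistent (var p)  w (a , a₀) = V-consistent w p (a₀ , a)
  I-consistent (∼ A)    w (a , a₀) = I-consistent A w (a₀ , a)
  I-consistent (A ∧' B) w ((a , b) , inj₁ a₀) = I-consistent A w (a , a₀)
  I-consistent (A ∧' B) w ((a , b) , inj₂ b₀) = I-consistent B w (b , b₀)
  I-consistent (A ∨' B) w (inj₁ a , a₀ , b₀) = I-consistent A w (a , a₀)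
  I-consistent (A ∨' B) w (inj₂ b , a₀ , b₀) = I-consistent B w (b , b₀)
  I-consistent (A ⇒ B)  w (f , ¬a₀ , b₀) with maxSucc w
  ... | m , w≤m , max with I-decided A max
  ...   | inj₂ a₀ = ¬a₀ m w≤m a₀
  ...   | inj₁ a with f m w≤m
  ...     | inj₁ ¬a = ¬a a
  ...     | inj₂ b = I-consistent B m (b , I0-mono B w≤m b₀)
  I-decided (var p) {m} max with V-potOmni m p m ≤-refl
  ... | y , m≤y , v with max y m≤y
  ...   | refl = [ inj₂ , inj₁ ] v
  I-decided ⊥'       max = inj₂ tt
  I-decided (∼ A)    max = [ inj₂ , inj₁ ] (I-decided A max)
  I-decided (A ∧' B) max with I-decided A max | I-decided B max
  ... | inj₁ a  | inj₁ b = inj₁ (a , b)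
  ... | inj₂ a₀ | _      = inj₂ (inj₁ a₀)
  ... | _       | inj₂ b₀ = inj₂ (inj₂ b₀)
  I-decided (A ∨' B) max with I-decided A max | I-decided B max
  ... | inj₂ a₀ | inj₂ b₀ = inj₂ (a₀ , b₀)
  ... | inj₁ a  | _       = inj₁ (inj₁ a)
  ... | _       | inj₁ b  = inj₁ (inj₂ b)
  I-decided (A ⇒ B) max with I-decided A max
  ... | inj₂ a₀ = inj₁ λ x m≤x → inj₁ λ a → I-consistent A x (a , I0-mono A m≤x a₀)
  ... | inj₁ a with I-decided B max
  ...   | inj₁ b  = inj₁ λ x m≤x → inj₂ (I1-mono B m≤x b)
  ...   | inj₂ b₀ = inj₂ ((λ x m≤x a₀ → I-consistent A x (I1-mono A m≤x a , a₀)) , b₀)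

Fin2-pigeonhole : (a b c : Fin 2) → a ≡ b ⊎ a ≡ c ⊎ b ≡ c
Fin2-pigeonhole 0F 0F _  = inj₁ refl
Fin2-pigeonhole 1F 1F _  = inj₁ refl
Fin2-pigeonhole 0F 1F 0F = inj₂ (inj₁ refl)
Fin2-pigeonhole 1F 0F 1F = inj₂ (inj₁ refl)
Fin2-pigeonhole 0F 1F 1F = inj₂ (inj₂ refl)
Fin2-pigeonhole 1F 0F 0F = inj₂ (inj₂ refl)

module Validity (em : ExcludedMiddle 0ℓ) (M : Model) where
  open Model M
  open Interp M
  open Semantics M
  open IsPartialOrder partialOrder using () renaming (refl to ≤-refl; trans to ≤-trans)

  ⇒-intro : ∀ {w} A B → (∀ x → w ≤ x → I1 x A → I1 x B) → I1 w (A ⇒ B)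
  ⇒-intro A B f x w≤x with em {I1 x A}
  ... | yes a = inj₂ (f x w≤x a)
  ... | no ¬a = inj₁ ¬a

  ⇒-elim : ∀ {w} A B → I1 w (A ⇒ B) → ∀ x → w ≤ x → I1 x A → I1 x B
  ⇒-elim A B f x w≤x a = [ (λ ¬a → ⊥-elim (¬a a)) , id ] (f x w≤x)

  ⇔-intro : ∀ {w} A B → (∀ x → w ≤ x → I1 x A → I1 x B) → (∀ x → w ≤ x → I1 x B → I1 x A) →
            I1 w (A ⇔' B)
  ⇔-intro A B f g = ⇒-intro A B f , ⇒-intro B A g

  three-worlds-collide : AtMostTwo M → (a b c : W) → a ≡ b ⊎ a ≡ c ⊎ b ≡ c
  three-worlds-collide (f , f-inj) a b c with Fin2-pigeonhole (f a) (f b) (f c)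
  ... | inj₁ eq        = inj₁ (f-inj eq)
  ... | inj₂ (inj₁ eq) = inj₂ (inj₁ (f-inj eq))
  ... | inj₂ (inj₂ eq) = inj₂ (inj₂ (f-inj eq))

  G-valid : AtMostTwo M → ∀ A B w → I1 w ((A ∨' (A ⇒ B)) ∨' (¬' B))
  G-valid two A B w with em {I1 w A}
  ... | yes a = inj₁ (inj₁ a)
  ... | no ¬a with em {I1 w (A ⇒ B)}
  ...   | yes f = inj₁ (inj₂ f)
  ...   | no ¬f = inj₂ λ x w≤x → inj₁ λ b → ¬f (⇒-intro A B λ y w≤y a → B-above x y w≤x w≤y b a)
    where
    B-above : ∀ x y → w ≤ x → w ≤ y → I1 x B → I1 y A → I1 y B
    B-above x y w≤x w≤y b a with three-worlds-collide two w x y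
    ... | inj₁ refl        = I1-mono B w≤y b
    ... | inj₂ (inj₁ refl) = ⊥-elim (¬a a)
    ... | inj₂ (inj₂ refl) = b

  axiom-valid : AtMostTwo M → ∀ {A} → Axiom A → ∀ w → I1 w A
  axiom-valid _ (ax-K A B) w = ⇒-intro A (B ⇒ A) λ x _ a → ⇒-intro B A λ y x≤y _ → I1-mono A x≤y a
  axiom-valid _ (ax-S A B C) w =
    ⇒-intro (A ⇒ (B ⇒ C)) ((A ⇒ B) ⇒ (A ⇒ C)) λ x _ f →
    ⇒-intro (A ⇒ B) (A ⇒ C) λ y x≤y g →
    ⇒-intro A C λ z y≤z a →
    ⇒-elim B C (⇒-elim A (B ⇒ C) f z (≤-trans x≤y y≤z) a) z ≤-refl (⇒-elim A B g z y≤z a)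
  axiom-valid _ (ax-∧E₁ A B) w = ⇒-intro (A ∧' B) A λ _ _ → proj₁
  axiom-valid _ (ax-∧E₂ A B) w = ⇒-intro (A ∧' B) B λ _ _ → proj₂
  axiom-valid _ (ax-∧I A B C) w =
    ⇒-intro (C ⇒ A) ((C ⇒ B) ⇒ (C ⇒ (A ∧' B))) λ x _ f →
    ⇒-intro (C ⇒ B) (C ⇒ (A ∧' B)) λ y x≤y g →
    ⇒-intro C (A ∧' B) λ z y≤z c → ⇒-elim C A f z (≤-trans x≤y y≤z) c , ⇒-elim C B g z y≤z c
  axiom-valid _ (ax-∨I₁ A B) w = ⇒-intro A (A ∨' B) λ _ _ → inj₁
  axiom-valid _ (ax-∨I₂ A B) w = ⇒-intro B (A ∨' B) λ _ _ → inj₂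
  axiom-valid _ (ax-∨E A B C) w =
    ⇒-intro (A ⇒ C) ((B ⇒ C) ⇒ ((A ∨' B) ⇒ C)) λ x _ f →
    ⇒-intro (B ⇒ C) ((A ∨' B) ⇒ C) λ y x≤y g →
    ⇒-intro (A ∨' B) C λ z y≤z →
    [ ⇒-elim A C f z (≤-trans x≤y y≤z) , ⇒-elim B C g z y≤z ]
  axiom-valid _ (ax-⊥E A) w = ⇒-intro ⊥' A λ _ _ ()
  axiom-valid _ (ax-∼⊥ A) w = ⇒-intro A (∼ ⊥') λ _ _ _ → tt
  axiom-valid _ (ax-∼∼ A) w = ⇔-intro (∼ (∼ A)) A (λ _ _ → id) (λ _ _ → id)
  axiom-valid _ (ax-∼∧ A B) w = ⇔-intro (∼ (A ∧' B)) ((∼ A) ∨' (∼ B)) (λ _ _ → id) (λ _ _ → id)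
  axiom-valid _ (ax-∼∨ A B) w = ⇔-intro (∼ (A ∨' B)) ((∼ A) ∧' (∼ B)) (λ _ _ → id) (λ _ _ → id)
  axiom-valid _ (ax-∼⇒ A B) w = ⇔-intro (∼ (A ⇒ B)) ((¬' (∼ A)) ∧' (∼ B))
    (λ _ _ (¬a₀ , b₀) → (λ y x≤y → inj₁ (¬a₀ y x≤y)) , b₀)
    (λ _ _ (¬a₀ , b₀) → (λ y x≤y → ⇒-elim (∼ A) ⊥' ¬a₀ y x≤y) , b₀)
  axiom-valid _ (ax-∼¬ A) w =
    ⇒-intro (∼ A) (¬' A) λ x _ a₀ y x≤y → inj₁ λ a → I-consistent A y (a , I0-mono A x≤y a₀)
  axiom-valid _ (ax-¬¬LEM A) w x _ = inj₁ λ ¬lem → ¬LEM-refuted (maxSucc x) ¬lem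
    where
    ¬LEM-refuted : ∀ {x} → (∃ λ m → x ≤ m × IsMaximal m) → ¬ I1 x (¬' (A ∨' (∼ A)))
    ¬LEM-refuted (m , x≤m , max) ¬lem with ¬lem m x≤m
    ... | inj₁ ¬a∨a₀ = ¬a∨a₀ (I-decided A max)
    ... | inj₂ ()
  axiom-valid two (ax-G A B) w = G-valid two A B w

  derivation-valid : AtMostTwo M → ∀ {Γ A} w → (∀ B → Γ B → I1 w B) → Γ ⊢ A → I1 w A
  derivation-valid two w Γ-holds (hyp γ) = Γ-holds _ γ
  derivation-valid two w Γ-holds (ax a) = axiom-valid two a w
  derivation-valid two w Γ-holds (mp {A} {B} d e) =
    ⇒-elim A B (derivation-valid two w Γ-holds e) w ≤-refl (derivation-valid two w Γ-holds d)

soundness : ExcludedMiddle 0ℓ → ∀ {Γ A} → Γ ⊢ A → Γ ⊨ A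
soundness em d M _ two w Γ-holds = Validity.derivation-valid em M two w Γ-holds d

_,,_ : Pred Form 0ℓ → Form → Pred Form 0ℓ
Γ ,, φ = Γ ∪ ｛ φ ｝

weaken : ∀ {Γ Δ A} → Γ ⊆ Δ → Γ ⊢ A → Δ ⊢ A
weaken Γ⊆Δ (hyp γ) = hyp (Γ⊆Δ γ)
weaken Γ⊆Δ (ax a) = ax a
weaken Γ⊆Δ (mp d e) = mp (weaken Γ⊆Δ d) (weaken Γ⊆Δ e)

cut : ∀ {Γ Δ A} → (∀ {B} → Γ B → Δ ⊢ B) → Γ ⊢ A → Δ ⊢ A
cut Δ⊢Γ (hyp γ) = Δ⊢Γ γ
cut Δ⊢Γ (ax a) = ax a
cut Δ⊢Γ (mp d e) = mp (cut Δ⊢Γ d) (cut Δ⊢Γ e)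

assumed : ∀ {Γ A} → (Γ ,, A) ⊢ A
assumed = hyp (inj₂ refl)

weaken-,, : ∀ {Γ A B} → Γ ⊢ B → (Γ ,, A) ⊢ B
weaken-,, = weaken inj₁

⊢-id : ∀ {Γ} A → Γ ⊢ (A ⇒ A)
⊢-id A = mp (ax (ax-K A A)) (mp (ax (ax-K A (A ⇒ A))) (ax (ax-S A (A ⇒ A) A)))

deduction : ∀ {Γ A B} → (Γ ,, A) ⊢ B → Γ ⊢ (A ⇒ B)
deduction {A = A} (hyp (inj₂ refl)) = ⊢-id A
deduction (hyp (inj₁ γ)) = mp (hyp γ) (ax (ax-K _ _))
deduction (ax a) = mp (ax a) (ax (ax-K _ _))
deduction {A = A} (mp {B} {C} d e) = mp (deduction d) (mp (deduction e) (ax (ax-S A B C)))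

DeductivelyClosed : Pred Form 0ℓ → Set
DeductivelyClosed T = ∀ {B} → T ⊢ B → T B

module ClosedTheory {T : Pred Form 0ℓ} (closed : DeductivelyClosed T) where

  ax∈ : ∀ {A} → Axiom A → T A
  ax∈ = closed ∘ ax

  mp∈ : ∀ {A B} → T A → T (A ⇒ B) → T B
  mp∈ a f = closed (mp (hyp a) (hyp f))

  ⇒-intro∈ : ∀ {A B} → (T ,, A) ⊢ B → T (A ⇒ B)
  ⇒-intro∈ = closed ∘ deduction

  ∧-⇔ : ∀ {A B} → (T A × T B) ⇔ T (A ∧' B)
  ∧-⇔ {A} {B} = mk⇔
    (λ (a , b) → closed (mp (hyp a) (mp (mp (hyp b) (ax (ax-K B A))) (mp (⊢-id A) (ax (ax-∧I A B A))))))
    (λ ab → mp∈ ab (ax∈ (ax-∧E₁ A B)) , mp∈ ab (ax∈ (ax-∧E₂ A B)))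

  ∨-intro : ∀ {A B} → T A ⊎ T B → T (A ∨' B)
  ∨-intro = [ (λ a → mp∈ a (ax∈ (ax-∨I₁ _ _))) , (λ b → mp∈ b (ax∈ (ax-∨I₂ _ _))) ]

  axiom-⇔ : ∀ {A B} → Axiom (A ⇔' B) → T A ⇔ T B
  axiom-⇔ a⇔b = mk⇔ (λ a → mp∈ a (proj₁ (from ∧-⇔ ax⇔))) (λ b → mp∈ b (proj₂ (from ∧-⇔ ax⇔)))
    where ax⇔ = ax∈ a⇔b

  const⇒ : ∀ {A B} → T B → T (A ⇒ B)
  const⇒ b = mp∈ b (ax∈ (ax-K _ _))

  ex-falso⇒ : ∀ {A B} → T (¬' A) → T (A ⇒ B)
  ex-falso⇒ ¬a = ⇒-intro∈ (mp (mp assumed (weaken-,, (hyp ¬a))) (ax (ax-⊥E _)))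

  ∼-contradiction : ∀ {A} → T (∼ A) → T A → T ⊥'
  ∼-contradiction a₀ a = mp∈ a (mp∈ a₀ (ax∈ (ax-∼¬ _)))

  ∼⊥∈ : T (∼ ⊥')
  ∼⊥∈ = mp∈ (ax∈ (ax-⊥E ⊥')) (ax∈ (ax-∼⊥ _))

  ¬¬-intro∈ : ∀ {A} → T ((¬' A) ⇒ A) → T (¬' (¬' A))
  ¬¬-intro∈ f = ⇒-intro∈ (mp (mp assumed (weaken-,, (hyp f))) assumed)

  ¬-∨ : ∀ {A B} → T (¬' A) → T (¬' B) → T (¬' (A ∨' B))
  ¬-∨ ¬a ¬b = ⇒-intro∈ (mp assumed (weaken-,, (mp (hyp ¬b) (mp (hyp ¬a) (ax (ax-∨E _ _ _))))))

  ¬-⇒ : ∀ {A B} → T (¬' (¬' A)) → T (¬' B) → T (¬' (A ⇒ B))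
  ¬-⇒ ¬¬a ¬b = ⇒-intro∈
    (mp (deduction (mp (mp assumed (weaken-,, assumed)) (weaken-,, (weaken-,, (hyp ¬b)))))
        (weaken-,, (hyp ¬¬a)))

-- Lindenbaum lemma

ascending : ∀ {a ℓ} {A : Set a} {P : ℕ → Pred A ℓ} → (∀ {n} → P n ⊆ P (suc n)) → ∀ {m n} → m ℕ.≤ n → P m ⊆ P n
ascending {P = P} step m≤n = go (≤⇒≤′ m≤n)
  where
  go : ∀ {m n} → m ≤′ n → P m ⊆ P n
  go (≤′-reflexive refl) = id
  go (≤′-step m≤′n) = step ∘ go m≤′n

compactness : ∀ {P : ℕ → Pred Form 0ℓ} → (∀ {n} → P n ⊆ P (suc n)) →
              ∀ {A} → (λ B → ∃ λ n → P n B) ⊢ A → ∃ λ n → P n ⊢ A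
compactness step (hyp (n , p)) = n , hyp p
compactness step (ax a) = 0 , ax a
compactness {P} step (mp d e) with compactness step d | compactness step e
... | m , d′ | n , e′ =
  m ⊔ n , mp (weaken (ascending {P = P} step (m≤m⊔n m n)) d′) (weaken (ascending {P = P} step (m≤n⊔m m n)) e′)

connectives : Form → Form → List Form
connectives A B = (A ∧' B) ∷ (A ∨' B) ∷ (A ⇒ B) ∷ []

formulas : ℕ → List Form
formulas zero = []
formulas (suc n) =
  var n ∷ ⊥' ∷ formulas n ++ map ∼_ (formulas n) ++ concat (cartesianProductWith connectives (formulas n) (formulas n))

formulas-mono : ∀ {m n} → m ℕ.≤ n → (_∈ formulas m) ⊆ (_∈ formulas n)
formulas-mono = ascending {P = λ n → _∈ formulas n} λ p → there (there (∈-++⁺ˡ p))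

∼-listed : ∀ {A n} → A ∈ formulas n → ∼ A ∈ formulas (suc n)
∼-listed {n = n} p = there (there (∈-++⁺ʳ (formulas n) (∈-++⁺ˡ (∈-map⁺ ∼_ p))))

connective-listed : ∀ {A B φ} → (∃ λ m → A ∈ formulas m) → (∃ λ n → B ∈ formulas n) →
                    φ ∈ connectives A B → ∃ λ n → φ ∈ formulas n
connective-listed (m , p) (n , q) r = suc (m ⊔ n) ,
  there (there (∈-++⁺ʳ (formulas (m ⊔ n)) (∈-++⁺ʳ (map ∼_ (formulas (m ⊔ n)))
    (∈-concat⁺′ r (∈-cartesianProductWith⁺ connectives
      (formulas-mono (m≤m⊔n m n) p) (formulas-mono (m≤n⊔m m n) q))))))

every-formula-listed : ∀ φ → ∃ λ n → φ ∈ formulas n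
every-formula-listed (var p) = suc p , here refl
every-formula-listed ⊥' = 1 , there (here refl)
every-formula-listed (∼ A) with every-formula-listed A
... | n , p = suc n , ∼-listed p
every-formula-listed (A ∧' B) =
  connective-listed (every-formula-listed A) (every-formula-listed B) (here refl)
every-formula-listed (A ∨' B) =
  connective-listed (every-formula-listed A) (every-formula-listed B) (there (here refl))
every-formula-listed (A ⇒ B) =
  connective-listed (every-formula-listed A) (every-formula-listed B) (there (there (here refl)))

record MaximalAvoiding (Γ : Pred Form 0ℓ) (A : Form) : Set₁ where
  field
    theory  : Pred Form 0ℓ
    closed  : DeductivelyClosed theory
    extends : Γ ⊆ theory
    avoids  : ¬ theory A
    maximal : ∀ φ → theory φ ⊎ (theory ,, φ) ⊢ A

module Lindenbaum (em : ExcludedMiddle 0ℓ) {Γ : Pred Form 0ℓ} {A : Form} (Γ⊬A : ¬ (Γ ⊢ A)) where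

  add : Pred Form 0ℓ → Form → Pred Form 0ℓ
  add Δ φ B = Δ B ⊎ (φ ≡ B × ¬ ((Δ ,, φ) ⊢ A))

  add-avoids : ∀ {Δ} φ → ¬ (Δ ⊢ A) → ¬ (add Δ φ ⊢ A)
  add-avoids {Δ} φ Δ⊬A d = Δ⊬A (weaken add⊆Δ d)
    where
    add⊆Δ : add Δ φ ⊆ Δ
    add⊆Δ (inj₁ δ) = δ
    add⊆Δ (inj₂ (_ , Δφ⊬A)) = ⊥-elim (Δφ⊬A (weaken (map₂ proj₁) d))

  add-decides : ∀ Δ φ → add Δ φ φ ⊎ (add Δ φ ,, φ) ⊢ A
  add-decides Δ φ with em {(Δ ,, φ) ⊢ A}
  ... | no Δφ⊬A = inj₁ (inj₂ (refl , Δφ⊬A))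
  ... | yes Δφ⊢A = inj₂ (weaken (map₁ inj₁) Δφ⊢A)

  addAll : Pred Form 0ℓ → List Form → Pred Form 0ℓ
  addAll = foldl add

  addAll-extends : ∀ {Δ} l → Δ ⊆ addAll Δ l
  addAll-extends [] = id
  addAll-extends (φ ∷ l) = addAll-extends l ∘ inj₁

  addAll-avoids : ∀ {Δ} l → ¬ (Δ ⊢ A) → ¬ (addAll Δ l ⊢ A)
  addAll-avoids [] = id
  addAll-avoids (φ ∷ l) = addAll-avoids l ∘ add-avoids φ

  addAll-decides : ∀ Δ {φ l} → φ ∈ l → addAll Δ l φ ⊎ (addAll Δ l ,, φ) ⊢ A
  addAll-decides Δ {l = φ ∷ l} (here refl) with add-decides Δ φ
  ... | inj₁ φ∈ = inj₁ (addAll-extends l φ∈)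
  ... | inj₂ d = inj₂ (weaken (map₁ (addAll-extends l)) d)
  addAll-decides Δ {l = ψ ∷ l} (there p) = addAll-decides (add Δ ψ) p

  stage : ℕ → Pred Form 0ℓ
  stage zero = Γ
  stage (suc n) = addAll (stage n) (formulas n)

  stage-avoids : ∀ n → ¬ (stage n ⊢ A)
  stage-avoids zero = Γ⊬A
  stage-avoids (suc n) = addAll-avoids (formulas n) (stage-avoids n)

  limit : Pred Form 0ℓ
  limit B = ∃ λ n → stage n B

  limit-avoids : ¬ (limit ⊢ A)
  limit-avoids d with compactness {stage} (λ {n} → addAll-extends {stage n} (formulas n)) d
  ... | n , stage⊢A = stage-avoids n stage⊢A

  limit-maximal : ∀ φ → (limit ⊢_) φ ⊎ ((limit ⊢_) ,, φ) ⊢ A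
  limit-maximal φ with every-formula-listed φ
  ... | n , p with addAll-decides (stage n) p
  ...   | inj₁ φ∈ = inj₁ (hyp (suc n , φ∈))
  ...   | inj₂ d = inj₂ (weaken (map₁ (λ B∈ → hyp (suc n , B∈))) d)

  extension : MaximalAvoiding Γ A
  extension = record
    { theory  = limit ⊢_
    ; closed  = cut id
    ; extends = λ γ → hyp (0 , γ)
    ; avoids  = limit-avoids
    ; maximal = limit-maximal
    }

module _ {Γ A} (E : MaximalAvoiding Γ A) where
  open MaximalAvoiding E
  open ClosedTheory closed

  avoiding-consistent : ¬ theory ⊥'
  avoiding-consistent t = avoids (mp∈ t (ax∈ (ax-⊥E A)))

  avoiding-prime : ∀ {B C} → theory (B ∨' C) → theory B ⊎ theory C
  avoiding-prime {B} {C} t with maximal B | maximal C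
  ... | inj₁ b  | _      = inj₁ b
  ... | _       | inj₁ c = inj₂ c
  ... | inj₂ b⊢A | inj₂ c⊢A =
    ⊥-elim (avoids (mp∈ t (closed (mp (deduction c⊢A) (mp (deduction b⊢A) (ax (ax-∨E B C A)))))))

-- Canonical model

module Canonical (em : ExcludedMiddle 0ℓ) {T : Pred Form 0ℓ} (closed : DeductivelyClosed T)
                 (consistent : ¬ T ⊥') (prime : ∀ {B C} → T (B ∨' C) → T B ⊎ T C) where
  open ClosedTheory closed

  T⁺ : Pred Form 0ℓ
  T⁺ B = ¬ T (¬' B)

  T⊆T⁺ : T ⊆ T⁺
  T⊆T⁺ b ¬b = consistent (mp∈ b ¬b)

  T⁺-stable : ∀ {B} → ¬ T⁺ B → T (¬' B)
  T⁺-stable = decidable-stable em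

  -- The G instance (¬B ∨ (¬B ⇒ B)) ∨ ¬B, split by primeness of T, is what closes T⁺ under MP.
  T⁺-mp : ∀ {B C} → T⁺ B → T⁺ (B ⇒ C) → T⁺ C
  T⁺-mp {B} b f ¬c with prime (ax∈ (ax-G (¬' B) B))
  ... | inj₂ ¬b = b ¬b
  ... | inj₁ g with prime g
  ...   | inj₁ ¬b = b ¬b
  ...   | inj₂ ¬b⇒b = f (¬-⇒ (¬¬-intro∈ ¬b⇒b) ¬c)

  T⁺-closed : DeductivelyClosed T⁺
  T⁺-closed (hyp b) = b
  T⁺-closed (ax a) = T⊆T⁺ (ax∈ a)
  T⁺-closed (mp d e) = T⁺-mp (T⁺-closed d) (T⁺-closed e)

  T⁺-consistent : ¬ T⁺ ⊥'
  T⁺-consistent t = t (ax∈ (ax-⊥E ⊥'))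

  T⁺-prime : ∀ {B C} → T⁺ (B ∨' C) → T⁺ B ⊎ T⁺ C
  T⁺-prime {B} {C} t with em {T⁺ B} | em {T⁺ C}
  ... | yes b | _     = inj₁ b
  ... | _     | yes c = inj₂ c
  ... | no ¬b | no ¬c = ⊥-elim (t (¬-∨ (T⁺-stable ¬b) (T⁺-stable ¬c)))

  _≼_ : Fin 2 → Fin 2 → Set
  _≼_ = _≤ᶠ_

  ≼-refl : ∀ {w} → w ≼ w
  ≼-refl = ≤ᶠ-refl

  theoryAt : Fin 2 → Pred Form 0ℓ
  theoryAt 0F = T
  theoryAt 1F = T⁺

  theoryAt-mono : ∀ {w x} → w ≼ x → theoryAt w ⊆ theoryAt x
  theoryAt-mono {0F} {0F} _ = id
  theoryAt-mono {0F} {1F} _ = T⊆T⁺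
  theoryAt-mono {1F} {1F} _ = id

  closed-at : ∀ w → DeductivelyClosed (theoryAt w)
  closed-at 0F = closed
  closed-at 1F = T⁺-closed

  consistent-at : ∀ w → ¬ theoryAt w ⊥'
  consistent-at 0F = consistent
  consistent-at 1F = T⁺-consistent

  prime-at : ∀ w {B C} → theoryAt w (B ∨' C) → theoryAt w B ⊎ theoryAt w C
  prime-at 0F = prime
  prime-at 1F = T⁺-prime

  module At (w : Fin 2) = ClosedTheory (closed-at w)

  valuation : Fin 2 → ℕ → TV → Set
  valuation w p 𝟙 = theoryAt w (var p)
  valuation w p 𝟘 = theoryAt w (∼ var p)

  T⁺-decides-var : ∀ p → valuation 1F p 𝟘 ⊎ valuation 1F p 𝟙
  T⁺-decides-var p with T⁺-prime (λ ¬lem → consistent (mp∈ ¬lem (ax∈ (ax-¬¬LEM (var p)))))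
  ... | inj₁ v = inj₂ v
  ... | inj₂ v₀ = inj₁ v₀

  top-maximal : (x : Fin 2) → 1F ≼ x → x ≡ 1F
  top-maximal 1F _ = refl

  model : Model
  model = record
    { W = Fin 2
    ; _≤_ = _≼_
    ; V = valuation
    ; inhabited = 0F
    ; partialOrder = ≤-isPartialOrder
    ; maxSucc = λ w → 1F , ≤fromℕ w , top-maximal
    ; V-consistent = λ w p (v₀ , v) → consistent-at w (At.∼-contradiction w v₀ v)
    ; V-monotone = λ { p 𝟘 w≤x → theoryAt-mono w≤x ; p 𝟙 w≤x → theoryAt-mono w≤x }
    ; V-potOmni = λ w p x _ → 1F , ≤fromℕ x , T⁺-decides-var p
    }

  open Interp model

  -- D failing at the top world already puts ¬D into T, the least theory.
  ¬-⇔ : ∀ w {D} → (∀ x → w ≼ x → ¬ theoryAt x D) ⇔ theoryAt w (¬' D)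
  ¬-⇔ w = mk⇔
    (λ h → theoryAt-mono {0F} {w} z≤n (T⁺-stable (h 1F (≤fromℕ w))))
    (λ ¬d x w≤x d → consistent-at x (At.mp∈ x d (theoryAt-mono w≤x ¬d)))

  Truth₁ Truth₀ : Form → Set
  Truth₁ B = ∀ w → I1 w B ⇔ theoryAt w B
  Truth₀ B = ∀ w → I0 w B ⇔ theoryAt w (∼ B)

  ⇒-truth-bottom : ∀ {B C} → Truth₁ B → Truth₁ C → I1 0F (B ⇒ C) → T (B ⇒ C)
  ⇒-truth-bottom {B} {C} B-truth C-truth f with prime (ax∈ (ax-G B C))
  ... | inj₂ ¬c with f 1F z≤n
  ...   | inj₁ ¬b = ex-falso⇒ (T⁺-stable (¬b ∘ from (B-truth 1F)))
  ...   | inj₂ c = ⊥-elim (to (C-truth 1F) c ¬c)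
  ⇒-truth-bottom {B} {C} B-truth C-truth f | inj₁ g with prime g
  ... | inj₂ b⇒c = b⇒c
  ... | inj₁ b with f 0F ≼-refl
  ...   | inj₁ ¬b = ⊥-elim (¬b (from (B-truth 0F) b))
  ...   | inj₂ c = const⇒ (to (C-truth 0F) c)

  ⇒-truth-top : ∀ {B C} → Truth₁ B → Truth₁ C → I1 1F (B ⇒ C) → T⁺ (B ⇒ C)
  ⇒-truth-top B-truth C-truth f with f 1F ≼-refl
  ... | inj₁ ¬b = At.ex-falso⇒ 1F (T⊆T⁺ (T⁺-stable (¬b ∘ from (B-truth 1F))))
  ... | inj₂ c = At.const⇒ 1F (to (C-truth 1F) c)

  ⇒-truth : ∀ {B C} → Truth₁ B → Truth₁ C → Truth₁ (B ⇒ C)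
  ⇒-truth {B} {C} B-truth C-truth w = mk⇔ (to-theory w) λ f x w≤x → from-theory x (theoryAt-mono w≤x f)
    where
    to-theory : ∀ w → I1 w (B ⇒ C) → theoryAt w (B ⇒ C)
    to-theory 0F = ⇒-truth-bottom B-truth C-truth
    to-theory 1F = ⇒-truth-top B-truth C-truth
    from-theory : ∀ x → theoryAt x (B ⇒ C) → ¬ I1 x B ⊎ I1 x C
    from-theory x f with em {I1 x B}
    ... | no ¬b = inj₁ ¬b
    ... | yes b = inj₂ (from (C-truth x) (At.mp∈ x (to (B-truth x) b) f))

  truth₁ : ∀ B → Truth₁ B
  truth₀ : ∀ B → Truth₀ B
  truth₁ (var p) w = ⇔-refl
  truth₁ ⊥' w = mk⇔ (λ ()) (consistent-at w)
  truth₁ (∼ B) w = truth₀ B w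
  truth₁ (B ∧' C) w = ⇔-trans (truth₁ B w ×-⇔ truth₁ C w) (At.∧-⇔ w)
  truth₁ (B ∨' C) w = ⇔-trans (truth₁ B w ⊎-⇔ truth₁ C w) (mk⇔ (At.∨-intro w) (prime-at w))
  truth₁ (B ⇒ C) = ⇒-truth (truth₁ B) (truth₁ C)
  truth₀ (var p) w = ⇔-refl
  truth₀ ⊥' w = mk⇔ (const (At.∼⊥∈ w)) (const tt)
  truth₀ (∼ B) w = ⇔-trans (truth₁ B w) (⇔-sym (At.axiom-⇔ w (ax-∼∼ B)))
  truth₀ (B ∧' C) w = ⇔-trans (⇔-trans (truth₀ B w ⊎-⇔ truth₀ C w) (mk⇔ (At.∨-intro w) (prime-at w)))
                              (⇔-sym (At.axiom-⇔ w (ax-∼∧ B C)))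
  truth₀ (B ∨' C) w = ⇔-trans (⇔-trans (truth₀ B w ×-⇔ truth₀ C w) (At.∧-⇔ w))
                              (⇔-sym (At.axiom-⇔ w (ax-∼∨ B C)))
  truth₀ (B ⇒ C) w = ⇔-trans (⇔-trans (¬-truth ×-⇔ truth₀ C w) (At.∧-⇔ w))
                             (⇔-sym (At.axiom-⇔ w (ax-∼⇒ B C)))
    where
    ¬-truth : (∀ x → w ≼ x → ¬ I0 x B) ⇔ theoryAt w (¬' (∼ B))
    ¬-truth = ⇔-trans
      (mk⇔ (λ h x w≤x → h x w≤x ∘ from (truth₀ B x)) (λ h x w≤x → h x w≤x ∘ to (truth₀ B x)))
      (¬-⇔ w)

completeness : ExcludedMiddle 0ℓ → ∀ {Γ A} → Γ ⊨ A → Γ ⊢ A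
completeness em {Γ} {A} Γ⊨A = decidable-stable em λ Γ⊬A →
  let E = Lindenbaum.extension em Γ⊬A
      open MaximalAvoiding E
      open Canonical em closed (avoiding-consistent E) (avoiding-prime E)
  in avoids (to (truth₁ A 0F) (Γ⊨A model ≤-total (id , id) 0F λ B γ → from (truth₁ B 0F) (extends γ)))

theorem4p1 : ExcludedMiddle 0ℓ → (Γ : Form → Set) (A : Form) → (Γ ⊢ A) ⇔ (Γ ⊨ A)
theorem4p1 em Γ A = mk⇔ (soundness em) (completeness em)
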